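{- Let $p,q,r$ be integers with $1\le p\le q\le r\le 2q$. For integers $p',q',r'$, let $\min(p',q',r';|V|)$ denote the minimum of $|V(G)|$ over all connected finite simple graphs $G$ with $\mathrm{ind\text{ - }match}(G)=p'$, $\mathrm{min\text{ - }match}(G)=q'$ and $\mathrm{match}(G)=r'$. Then: (1) $\min(1,q,r;|V|)=2r$; (2) $\min(p,q,r;|V|)=2r$ if $2\le p\le q<r\le 2q$; (3) $\min(p,r,r;|V|)=2r+1$ if $2\le p\le q=r$.
   Context: All graphs are finite and simple. A matching of $G$ is a set of pairwise disjoint edges. A maximal matching is a matching not properly contained in another matching. An induced matching is a matching $M$ such that for distinct $e,f\in M$ there is no edge $g$ of $G$ meeting both $e$ and $f$. $\mathrm{match}(G)$ is the maximum size of a matching, $\mathrm{min\text{ - }match}(G)$ the minimum size of a maximal matching, and $\mathrm{ind\text{ - }match}(G)$ the maximum size of an induced matching of $G$. For every $1\le p\le q\le r\le 2q$ there exists a connected graph with these three invariants equal to $p,q,r$. -}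

module Defs where

open import Data.Nat using (ℕ; _≤_; _≥_)
open import Data.Fin using (Fin)
open import Data.Bool using (Bool; true; false)
open import Data.Product using (_×_; _,_; Σ; ∃)
open import Data.Sum using (_⊎_)
open import Data.List using (List; length)
open import Data.List.Relation.Unary.All using (All)
open import Data.List.Relation.Unary.Any using (Any)
open import Data.List.Relation.Unary.AllPairs using (AllPairs)
open import Relation.Binary.PropositionalEquality using (_≡_; _≢_)
open import Relation.Nullary using (¬_)

record Graph (n : ℕ) : Set where
  field
    adj    : Fin n → Fin n → Bool
    sym    : ∀ u v → adj u v ≡ adj v u
    irrefl : ∀ u → adj u u ≡ false
open Graph public

-- An edge is written as a pair of endpoints (unordered: see SameEdge).
Edge : ℕ → Set
Edge n = Fin n × Fin n

module _ {n : ℕ} (G : Graph n) where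

  IsEdge : Edge n → Set
  IsEdge (u , v) = adj G u v ≡ true

  Incident : Fin n → Edge n → Set
  Incident x (u , v) = (x ≡ u) ⊎ (x ≡ v)

  Meet : Edge n → Edge n → Set
  Meet e f = ∃ λ x → Incident x e × Incident x f

  SameEdge : Edge n → Edge n → Set
  SameEdge (a , b) (c , d) = ((a ≡ c) × (b ≡ d)) ⊎ ((a ≡ d) × (b ≡ c))

  -- a set of edges, represented by a list; the edge set is
  -- { e | EdgeIn e M }.
  EdgeIn : Edge n → List (Edge n) → Set
  EdgeIn e M = Any (SameEdge e) M

  -- A matching: a set of edges of G that are pairwise disjoint.
  -- (Pairwise disjointness of all list entries also rules out repeats,
  -- so the size of the matching is the length of the list.)
  IsMatching : List (Edge n) → Set
  IsMatching M = All IsEdge M × AllPairs (λ e f → ¬ Meet e f) M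

  IsMaximalMatching : List (Edge n) → Set
  IsMaximalMatching M =
    IsMatching M ×
    (∀ M' → IsMatching M' → (∀ e → EdgeIn e M → EdgeIn e M') →
            (∀ e → EdgeIn e M' → EdgeIn e M))

  IsInducedMatching : List (Edge n) → Set
  IsInducedMatching M =
    IsMatching M ×
    AllPairs (λ e f → ∀ g → IsEdge g → ¬ (Meet g e × Meet g f)) M

  MatchNumber : ℕ → Set
  MatchNumber k =
    (Σ (List (Edge n)) λ M → IsMatching M × length M ≡ k) ×
    (∀ M → IsMatching M → length M ≤ k)

  MinMatchNumber : ℕ → Set
  MinMatchNumber k =
    (Σ (List (Edge n)) λ M → IsMaximalMatching M × length M ≡ k) ×
    (∀ M → IsMaximalMatching M → k ≤ length M)

  IndMatchNumber : ℕ → Set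
  IndMatchNumber k =
    (Σ (List (Edge n)) λ M → IsInducedMatching M × length M ≡ k) ×
    (∀ M → IsInducedMatching M → length M ≤ k)

  data Reachable : Fin n → Fin n → Set where
    here : ∀ {u} → Reachable u u
    step : ∀ {u v w} → adj G u v ≡ true → Reachable v w → Reachable u w

  Connected : Set
  Connected = ∀ u v → Reachable u v

Realizes : ∀ {n} → Graph n → ℕ → ℕ → ℕ → Set
Realizes G p q r =
  Connected G × IndMatchNumber G p × MinMatchNumber G q × MatchNumber G r

MinOrder : ℕ → ℕ → ℕ → ℕ → Set
MinOrder p q r m =
  (Σ (Graph m) λ G → Realizes G p q r) ×
  (∀ n (G : Graph n) → Realizes G p q r → m ≤ n)

{-# OPTIONS --safe #-}
module Submission where

-- A matching with r edges has 2r distinct endpoints.  If moreover p ≥ 2, q = r and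
-- the graph has at most 2r vertices, then every maximal matching is perfect, since one missing a
-- vertex would have fewer than r edges.  In such a graph, let P be a perfect matching with partner
-- map u ↦ u′.  For an edge uv ∉ P, also u′v′ is an edge: otherwise exchanging uu′ and vv′ for uv
-- leaves exactly the non-adjacent u′ and v′ uncovered, in a maximal matching that is not perfect.
-- A second exchange of this kind shows that the set of vertices at distance at most one from an
-- edge aa′ of P is closed under adjacency, hence everything in a connected graph.  As every edge
-- lies in some perfect matching, no two edges form an induced matching.
--
-- On A = {0, …, 2q − 1} take the pairs {2h, 2h + 1}; the first q − p + 1 of them
-- together span one clique, each of the other p − 1 is a single edge.  Add an independent set B of
-- t vertices joined to all of A.  Every edge meets a clique, and an induced matching meets each
-- clique at most once, so ind-match = p.
-- For a maximal matching M, a vertex not covered by M is the only such vertex of the big clique,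
-- or lies in B, or is the sibling of an A-vertex matched to a vertex of B.  Charging the last two
-- kinds to vertices of B gives 2q + t ≤ 2|M| + 1 + t, so min-match = q.  If 2m ≤ t ≤ 2m + 1 then
-- match = q + m, realised by matching m + m vertices of B into A and pairing up the rest.  Choosing
-- t = 2(r − q), or t = 1 when q = r, gives 2r, resp. 2r + 1, vertices; the graph is connected
-- as soon as B is nonempty or p = 1.

open import Defs
open import Data.Nat using (ℕ; _≤_; _<_; _+_; _*_; suc)
open import Data.Product using (_×_)
open import Relation.Binary.PropositionalEquality using (_≡_)

open import Data.Nat using (zero; _∸_; z≤n; s≤s; _≟_; _<?_; ⌊_/2⌋)
open import Data.Nat.Properties
open import Data.Nat.Tactic.RingSolver using (solve-∀)
open import Data.Fin as Fin using (Fin; toℕ)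
import Data.Fin.Properties as Fin
open import Data.Bool using (true; false)
open import Data.Product using (Σ; _,_; proj₁; proj₂)
open import Data.Sum as Sum using (_⊎_; inj₁; inj₂)
open import Data.Empty using (⊥; ⊥-elim)
open import Data.List using (List; []; _∷_; length; map; _++_; lookup; filter; applyUpTo)
open import Data.List.Properties using (length-map; length-++; length-applyUpTo)
open import Data.List.Relation.Unary.All as All using (All; []; _∷_)
import Data.List.Relation.Unary.All.Properties as All
open import Data.List.Relation.Unary.Any as Any using (Any; here; there)
import Data.List.Relation.Unary.Any.Properties as Any
open import Data.List.Relation.Unary.AllPairs as AllPairs using (AllPairs; []; _∷_)
import Data.List.Relation.Unary.AllPairs.Properties as AllPairs
open import Data.List.Relation.Unary.Unique.Propositional using (Unique)
open import Data.List.Membership.Propositional using (_∈_; find; lose)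
open import Data.List.Membership.Propositional.Properties
  using (∈-lookup; ∈-++⁺ˡ; ∈-++⁺ʳ; ∈-++⁻; ∈-map⁺; ∈-applyUpTo⁺; ∈-filter⁺; ∈-filter⁻)
open import Relation.Binary.PropositionalEquality using (_≢_; refl; trans; cong; cong₂; subst; subst₂)
import Relation.Binary.PropositionalEquality as ≡
open import Function using (case_of_; _∘_)
open import Relation.Nullary using (¬_; Dec; yes; no; does)
open import Relation.Unary using (Decidable)
open import Relation.Nullary.Decidable using (dec-true; dec-false; _×-dec_; _⊎-dec_; _→-dec_; ¬?)

lookup-injective : ∀ {A : Set} {xs : List A} → Unique xs →
                   ∀ i j → lookup xs i ≡ lookup xs j → i ≡ j
lookup-injective (_ ∷ _) Fin.zero Fin.zero _ = refl
lookup-injective (x≢ ∷ _) Fin.zero (Fin.suc j) eq = ⊥-elim (All.lookup x≢ (∈-lookup j) eq)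
lookup-injective (x≢ ∷ _) (Fin.suc i) Fin.zero eq = ⊥-elim (All.lookup x≢ (∈-lookup i) (≡.sym eq))
lookup-injective (_ ∷ u) (Fin.suc i) (Fin.suc j) eq = cong Fin.suc (lookup-injective u i j eq)

Unique⇒length≤ : ∀ {n} {xs : List (Fin n)} → Unique xs → length xs ≤ n
Unique⇒length≤ u = Fin.injective⇒≤ (λ {i} {j} → lookup-injective u i j)

Unique-bounded⇒length≤ : ∀ {k} {xs : List ℕ} → Unique xs → All (_< k) xs → length xs ≤ k
Unique-bounded⇒length≤ {xs = xs} u bounded = Fin.injective⇒≤ {f = toFin} λ {i} {j} eq →
  lookup-injective u i j (trans (≡.sym (Fin.toℕ-fromℕ< _)) (trans (cong toℕ eq) (Fin.toℕ-fromℕ< _)))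
  where
  toFin : Fin (length xs) → Fin _
  toFin i = Fin.fromℕ< (All.lookup bounded (∈-lookup i))

AllPairs-annotate : ∀ {A : Set} {P : A → Set} {R : A → A → Set} {xs : List A} →
                    All P xs → AllPairs R xs → AllPairs (λ x y → P x × P y × R x y) xs
AllPairs-annotate [] [] = []
AllPairs-annotate (px ∷ pxs) (rx ∷ rxs) =
  All.zipWith (λ (py , r) → px , py , r) (pxs , rx) ∷ AllPairs-annotate pxs rxs

enumeration⇒≤length : ∀ {n} {xs : List (Fin n)} → (∀ z → z ∈ xs) → n ≤ length xs
enumeration⇒≤length {xs = xs} complete = Fin.injective⇒≤ {f = λ z → Any.index (complete z)}
  λ {z} {w} eq → trans (Any.lookup-index (complete z))
                        (trans (cong (lookup xs) eq) (≡.sym (Any.lookup-index (complete w))))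

module _ {n : ℕ} (G : Graph n) where

  open import Data.List.Membership.DecPropositional (Fin._≟_ {n}) using (_∈?_)

  edge-irreflexive : ∀ {u v} → adj G u v ≡ true → u ≢ v
  edge-irreflexive {u} e refl = case trans (≡.sym e) (irrefl G u) of λ ()

  edge-sym : ∀ {u v} → adj G u v ≡ true → adj G v u ≡ true
  edge-sym {u} {v} e = trans (sym G v u) e

  SameEdge-refl : ∀ {e} → SameEdge G e e
  SameEdge-refl = inj₁ (refl , refl)

  SameEdge-flip : ∀ {u v} → SameEdge G (u , v) (v , u)
  SameEdge-flip = inj₂ (refl , refl)

  SameEdge-sym : ∀ {e f} → SameEdge G e f → SameEdge G f e
  SameEdge-sym (inj₁ (refl , refl)) = SameEdge-refl
  SameEdge-sym (inj₂ (refl , refl)) = SameEdge-flip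

  SameEdge-trans : ∀ {e f g} → SameEdge G e f → SameEdge G f g → SameEdge G e g
  SameEdge-trans (inj₁ (refl , refl)) s = s
  SameEdge-trans (inj₂ (refl , refl)) (inj₁ (refl , refl)) = SameEdge-flip
  SameEdge-trans (inj₂ (refl , refl)) (inj₂ (refl , refl)) = SameEdge-refl

  Incident-resp : ∀ {x e f} → SameEdge G e f → Incident G x e → Incident G x f
  Incident-resp (inj₁ (refl , refl)) i = i
  Incident-resp (inj₂ (refl , refl)) (inj₁ p) = inj₂ p
  Incident-resp (inj₂ (refl , refl)) (inj₂ p) = inj₁ p

  Meet-sym : ∀ {e f} → Meet G e f → Meet G f e
  Meet-sym (x , i , j) = x , j , i

  Meet-resp₂ : ∀ {e e' f f'} → SameEdge G e e' → SameEdge G f f' → Meet G e f → Meet G e' f'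
  Meet-resp₂ s t (x , i , j) = x , Incident-resp s i , Incident-resp t j

  EdgeIn-flip : ∀ {M u v} → EdgeIn G (u , v) M → EdgeIn G (v , u) M
  EdgeIn-flip = Any.map (SameEdge-trans SameEdge-flip)

  EdgeIn⇒IsEdge : ∀ {M e} → All (IsEdge G) M → EdgeIn G e M → IsEdge G e
  EdgeIn⇒IsEdge (p ∷ _) (here (inj₁ (refl , refl))) = p
  EdgeIn⇒IsEdge (p ∷ _) (here (inj₂ (refl , refl))) = edge-sym p
  EdgeIn⇒IsEdge (_ ∷ ps) (there a) = EdgeIn⇒IsEdge ps a

  endpoints : List (Edge n) → List (Fin n)
  endpoints [] = []
  endpoints ((u , v) ∷ M) = u ∷ v ∷ endpoints M

  length-endpoints : ∀ M → length (endpoints M) ≡ 2 * length M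
  length-endpoints [] = refl
  length-endpoints (_ ∷ M) =
    trans (cong (2 +_) (length-endpoints M)) (≡.sym (*-distribˡ-+ 2 1 (length M)))

  Covered : List (Edge n) → Fin n → Set
  Covered M z = z ∈ endpoints M

  covered? : ∀ M z → Dec (Covered M z)
  covered? M z = z ∈? endpoints M

  IsPerfectMatching : List (Edge n) → Set
  IsPerfectMatching M = IsMatching G M × (∀ z → Covered M z)

  incident⇒covered : ∀ {M z} → Any (Incident G z) M → Covered M z
  incident⇒covered {(u , v) ∷ M} (here (inj₁ p)) = here p
  incident⇒covered {(u , v) ∷ M} (here (inj₂ p)) = there (here p)
  incident⇒covered {(u , v) ∷ M} (there a) = there (there (incident⇒covered a))

  covered⇒incident : ∀ {M z} → Covered M z → Any (Incident G z) M
  covered⇒incident {(u , v) ∷ M} (here p) = here (inj₁ p)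
  covered⇒incident {(u , v) ∷ M} (there (here p)) = here (inj₂ p)
  covered⇒incident {(u , v) ∷ M} (there (there c)) = there (covered⇒incident c)

  covered-by : ∀ {M z e} → e ∈ M → Incident G z e → Covered M z
  covered-by e∈M i = incident⇒covered (lose e∈M i)

  EdgeIn⇒covered : ∀ {M u v} → EdgeIn G (u , v) M → Covered M u
  EdgeIn⇒covered a with find a
  ... | _ , e∈M , s = covered-by e∈M (Incident-resp s (inj₁ refl))

  mate : ∀ {M z} → Covered M z → Fin n
  mate {(u , v) ∷ _} (here _) = v
  mate {(u , v) ∷ _} (there (here _)) = u
  mate {_ ∷ _} (there (there c)) = mate c

  mate-edge : ∀ {M z} (c : Covered M z) → EdgeIn G (z , mate c) M
  mate-edge {(u , v) ∷ _} (here refl) = here SameEdge-refl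
  mate-edge {(u , v) ∷ _} (there (here refl)) = here SameEdge-flip
  mate-edge {_ ∷ _} (there (there c)) = there (mate-edge c)

  disjoint⇒distinct-endpoints : ∀ {e x M} → All (λ f → ¬ Meet G e f) M → Incident G x e →
                                All (x ≢_) (endpoints M)
  disjoint⇒distinct-endpoints [] i = []
  disjoint⇒distinct-endpoints {M = (c , d) ∷ M} (e#f ∷ e#M) i =
    (λ eq → e#f (_ , i , inj₁ eq)) ∷ (λ eq → e#f (_ , i , inj₂ eq)) ∷ disjoint⇒distinct-endpoints e#M i

  endpoints-unique : ∀ {M} → IsMatching G M → Unique (endpoints M)
  endpoints-unique {[]} _ = []
  endpoints-unique {(u , v) ∷ M} (e ∷ es , e#M ∷ M#M) =
    (edge-irreflexive e ∷ disjoint⇒distinct-endpoints e#M (inj₁ refl)) ∷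
    disjoint⇒distinct-endpoints e#M (inj₂ refl) ∷ endpoints-unique (es , M#M)

  matching-order-bound : ∀ {M U} → IsMatching G M → Unique U → All (λ z → ¬ Covered M z) U →
                   length U + 2 * length M ≤ n
  matching-order-bound {M} {U} matching uniqueU uncoveredU =
    subst (_≤ n) (trans (length-++ U) (cong (length U +_) (length-endpoints M)))
      (Unique⇒length≤ (AllPairs.++⁺ uniqueU (endpoints-unique matching)
                                       (All.map (All.¬Any⇒All¬ _) uncoveredU)))

  matching-same-or-disjoint : ∀ {M e f} → IsMatching G M → EdgeIn G e M → EdgeIn G f M →
                              Meet G e f → SameEdge G e f
  matching-same-or-disjoint _ (here s) (here t) _ = SameEdge-trans s (SameEdge-sym t)
  matching-same-or-disjoint (_ , g#M ∷ _) (here s) (there b) meet with All.lookupAny g#M b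
  ... | g#h , f≈h = ⊥-elim (g#h (Meet-resp₂ s f≈h meet))
  matching-same-or-disjoint (_ , g#M ∷ _) (there a) (here t) meet with All.lookupAny g#M a
  ... | g#h , e≈h = ⊥-elim (g#h (Meet-resp₂ t e≈h (Meet-sym meet)))
  matching-same-or-disjoint (_ ∷ es , _ ∷ M#M) (there a) (there b) meet =
    matching-same-or-disjoint (es , M#M) a b meet

  matching-mate-unique : ∀ {M z w w'} → IsMatching G M →
                         EdgeIn G (z , w) M → EdgeIn G (z , w') M → w ≡ w'
  matching-mate-unique {z = z} matching a b
    with matching-same-or-disjoint matching a b (z , inj₁ refl , inj₁ refl)
  ... | inj₁ (_ , w≡w') = w≡w'
  ... | inj₂ (_ , w≡z) = ⊥-elim (edge-irreflexive (EdgeIn⇒IsEdge (proj₁ matching) a) (≡.sym w≡z))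

  matching-++ : ∀ {M₁ M₂} → IsMatching G M₁ → IsMatching G M₂ →
                All (λ e → All (λ f → ¬ Meet G e f) M₂) M₁ → IsMatching G (M₁ ++ M₂)
  matching-++ (e₁ , d₁) (e₂ , d₂) cross = All.++⁺ e₁ e₂ , AllPairs.++⁺ d₁ d₂ cross

  two-edge-matching : ∀ {u₁ v₁ u₂ v₂} → adj G u₁ v₁ ≡ true → adj G u₂ v₂ ≡ true →
                      All (λ z → All (z ≢_) (u₂ ∷ v₂ ∷ [])) (u₁ ∷ v₁ ∷ []) →
                      IsMatching G ((u₁ , v₁) ∷ (u₂ , v₂) ∷ [])
  two-edge-matching e₁ e₂ ((u≢u ∷ u≢v ∷ []) ∷ (v≢u ∷ v≢v ∷ []) ∷ []) =
    (e₁ ∷ e₂ ∷ []) , ((disjoint ∷ []) ∷ [] ∷ [])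
    where
    disjoint : ¬ Meet G _ _
    disjoint (_ , inj₁ refl , inj₁ refl) = u≢u refl
    disjoint (_ , inj₁ refl , inj₂ refl) = u≢v refl
    disjoint (_ , inj₂ refl , inj₁ refl) = v≢u refl
    disjoint (_ , inj₂ refl , inj₂ refl) = v≢v refl

  IsVertexCover : (Fin n → Set) → Set
  IsVertexCover C = ∀ u v → adj G u v ≡ true → C u ⊎ C v

  vertexCover⇒maximal : ∀ {M} → IsMatching G M → IsVertexCover (Covered M) → IsMaximalMatching G M
  vertexCover⇒maximal {M} matching cover = matching , extension-inside
    where
    extension-inside : ∀ M' → IsMatching G M' → (∀ e → EdgeIn G e M → EdgeIn G e M') →
                       ∀ e → EdgeIn G e M' → EdgeIn G e M
    extension-inside M' matching' M⊆M' (u , v) e∈M' =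
      from-endpoint (cover u v (EdgeIn⇒IsEdge (proj₁ matching') e∈M'))
      where
      through : ∀ {x} → Incident G x (u , v) → Covered M x → EdgeIn G (u , v) M
      through {x} i c with find (covered⇒incident c)
      ... | f , f∈M , i' =
        lose f∈M (matching-same-or-disjoint matching' e∈M' (M⊆M' f (lose f∈M SameEdge-refl)) (x , i , i'))
      from-endpoint : Covered M u ⊎ Covered M v → EdgeIn G (u , v) M
      from-endpoint (inj₁ c) = through (inj₁ refl) c
      from-endpoint (inj₂ c) = through (inj₂ refl) c

  maximal⇒vertexCover : ∀ {M} → IsMaximalMatching G M → IsVertexCover (Covered M)
  maximal⇒vertexCover {M} (matching , maximal) u v e with covered? M u | covered? M v
  ... | yes c | _ = inj₁ c
  ... | no _ | yes c = inj₂ c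
  ... | no u∉ | no v∉ =
    ⊥-elim (u∉ (EdgeIn⇒covered (maximal ((u , v) ∷ M) extended (λ _ → there) (u , v) (here SameEdge-refl))))
    where
    disjoint : All (λ f → ¬ Meet G (u , v) f) M
    disjoint = All.tabulate λ where
      f∈M (_ , inj₁ refl , i) → u∉ (covered-by f∈M i)
      f∈M (_ , inj₂ refl , i) → v∉ (covered-by f∈M i)
    extended : IsMatching G ((u , v) ∷ M)
    extended = (e ∷ proj₁ matching) , (disjoint ∷ proj₂ matching)

  reach-trans : ∀ {a b c} → Reachable G a b → Reachable G b c → Reachable G a c
  reach-trans here r = r
  reach-trans (step e r) r' = step e (reach-trans r r')

  reach-sym : ∀ {a b} → Reachable G a b → Reachable G b a
  reach-sym here = here
  reach-sym (step e r) = reach-trans (reach-sym r) (step (edge-sym e) here)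

  hub⇒connected : (h : Fin n) → (∀ v → Reachable G v h) → Connected G
  hub⇒connected h reach u v = reach-trans (reach u) (reach-sym (reach v))

-- Graphs in which every maximal matching is perfect

module RandomlyMatchable {n : ℕ} (G : Graph n)
    (maximal⇒perfect : ∀ {M} → IsMaximalMatching G M → ∀ z → Covered G M z) where

  open import Data.List.Membership.DecPropositional (Fin._≟_ {n}) using (_∈?_)

  no-nonadjacent-gap : ∀ {N x y} → IsMatching G N → ¬ Covered G N x → ¬ Covered G N y →
                       adj G x y ≡ false → (∀ z → z ≢ x → z ≢ y → Covered G N z) → ⊥
  no-nonadjacent-gap {N} {x} {y} matching x∉ y∉ x≁y others =
    x∉ (maximal⇒perfect (vertexCover⇒maximal G matching cover) x)
    where
    gap : ∀ z → ¬ Covered G N z → z ≡ x ⊎ z ≡ y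
    gap z z∉ with z Fin.≟ x | z Fin.≟ y
    ... | yes p | _ = inj₁ p
    ... | no _ | yes p = inj₂ p
    ... | no p | no q = ⊥-elim (z∉ (others z p q))
    cover : IsVertexCover G (Covered G N)
    cover u v e with covered? G N u | covered? G N v
    ... | yes c | _ = inj₁ c
    ... | no _ | yes c = inj₂ c
    ... | no u∉ | no v∉ = ⊥-elim (gap-edge (gap u u∉) (gap v v∉))
      where
      gap-edge : u ≡ x ⊎ u ≡ y → v ≡ x ⊎ v ≡ y → ⊥
      gap-edge (inj₁ refl) (inj₁ refl) = edge-irreflexive G e refl
      gap-edge (inj₂ refl) (inj₂ refl) = edge-irreflexive G e refl
      gap-edge (inj₁ refl) (inj₂ refl) = case trans (≡.sym e) x≁y of λ ()
      gap-edge (inj₂ refl) (inj₁ refl) = case trans (≡.sym (edge-sym G e)) x≁y of λ ()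

  module PerfectMatching (P : List (Edge n)) (perfect : IsPerfectMatching G P) where

    partner : Fin n → Fin n
    partner z = mate G (proj₂ perfect z)

    partner-edge : ∀ z → EdgeIn G (z , partner z) P
    partner-edge z = mate-edge G (proj₂ perfect z)

    partner-unique : ∀ {z w} → EdgeIn G (z , w) P → w ≡ partner z
    partner-unique a = matching-mate-unique G (proj₁ perfect) a (partner-edge _)

    partner-involutive : ∀ z → partner (partner z) ≡ z
    partner-involutive z = ≡.sym (partner-unique (EdgeIn-flip G (partner-edge z)))

    partner-adjacent : ∀ z → adj G z (partner z) ≡ true
    partner-adjacent z = EdgeIn⇒IsEdge G (proj₁ (proj₁ perfect)) (partner-edge z)

    partner-≢ : ∀ z → partner z ≢ z
    partner-≢ z eq = edge-irreflexive G (partner-adjacent z) (≡.sym eq)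

    partner-injective : ∀ {a b} → partner a ≡ partner b → a ≡ b
    partner-injective {a} {b} eq =
      trans (≡.sym (partner-involutive a)) (trans (cong partner eq) (partner-involutive b))

    withPartners : List (Fin n) → List (Fin n)
    withPartners [] = []
    withPartners (s ∷ ss) = s ∷ partner s ∷ withPartners ss

    withPartners-closed : ∀ ss {z w} → EdgeIn G (z , w) P →
                          z ∈ withPartners ss → w ∈ withPartners ss
    withPartners-closed (s ∷ ss) a (here refl) = there (here (partner-unique a))
    withPartners-closed (s ∷ ss) a (there (here refl)) =
      here (trans (partner-unique a) (partner-involutive s))
    withPartners-closed (s ∷ ss) a (there (there z∈)) = there (there (withPartners-closed ss a z∈))

    -- Exchange the edges of P inside S = ss ∪ partner ss for a matching W on S.  As S is closed
    -- under partner, an edge of P lies inside S as soon as its first endpoint does.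
    module Swap (ss : List (Fin n)) (W : List (Edge n)) (matchingW : IsMatching G W)
                (W⊆S : All (_∈ withPartners ss) (endpoints G W)) where

      S : List (Fin n)
      S = withPartners ss

      outside? : Decidable (λ (e : Edge n) → ¬ proj₁ e ∈ S)
      outside? e = ¬? (proj₁ e ∈? S)

      N : List (Edge n)
      N = filter outside? P ++ W

      kept-avoids : ∀ {z e} → e ∈ filter outside? P → Incident G z e → ¬ z ∈ S
      kept-avoids k (inj₁ refl) = proj₂ (∈-filter⁻ outside? {xs = P} k)
      kept-avoids k (inj₂ refl) z∈ with ∈-filter⁻ outside? {xs = P} k
      ... | e∈P , a∉ = a∉ (withPartners-closed ss (EdgeIn-flip G (lose e∈P (SameEdge-refl G))) z∈)

      swap-matching : IsMatching G N
      swap-matching =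
        matching-++ G
          (All.filter⁺ outside? (proj₁ (proj₁ perfect)) , AllPairs.filter⁺ outside? (proj₂ (proj₁ perfect)))
          matchingW
          (All.tabulate λ k → All.tabulate λ f∈W → λ where
            (_ , i , j) → kept-avoids k i (All.lookup W⊆S (covered-by G f∈W j)))

      swap-covers-outside : ∀ {z} → ¬ z ∈ S → Covered G N z
      swap-covers-outside {z} z∉ with find (covered⇒incident G (proj₂ perfect z))
      ... | (a , b) , e∈P , i = covered-by G (∈-++⁺ˡ (∈-filter⁺ outside? e∈P a∉)) i
        where
        a∉ : ¬ a ∈ S
        a∉ a∈ = z∉ (endpoint-in-S i)
          where
          endpoint-in-S : Incident G z (a , b) → z ∈ S
          endpoint-in-S (inj₁ refl) = a∈
          endpoint-in-S (inj₂ refl) = withPartners-closed ss (lose e∈P (SameEdge-refl G)) a∈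

      swap-covers-W : ∀ {z} → Covered G W z → Covered G N z
      swap-covers-W c with find (covered⇒incident G c)
      ... | f , f∈W , i = covered-by G (∈-++⁺ʳ _ f∈W) i

      swap-uncovered : ∀ {z} → z ∈ S → ¬ Covered G W z → ¬ Covered G N z
      swap-uncovered z∈ z∉W c with find (covered⇒incident G c)
      ... | f , f∈N , i with ∈-++⁻ (filter outside? P) f∈N
      ... | inj₁ k = kept-avoids k i z∈
      ... | inj₂ f∈W = z∉W (covered-by G f∈W i)

      swap-covers : ∀ {z} → (z ∈ S → Covered G W z) → Covered G N z
      swap-covers {z} covers with z ∈? S
      ... | yes z∈ = swap-covers-W (covers z∈)
      ... | no z∉ = swap-covers-outside z∉

      swap-perfect : (∀ z → z ∈ S → Covered G W z) → IsPerfectMatching G N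
      swap-perfect covers = swap-matching , λ z → swap-covers (covers z)

      swap-gap : ∀ {x y} → x ∈ S → y ∈ S → ¬ Covered G W x → ¬ Covered G W y → adj G x y ≡ false →
                 (∀ z → z ∈ S → z ≢ x → z ≢ y → Covered G W z) → ⊥
      swap-gap x∈ y∈ x∉ y∉ x≁y others =
        no-nonadjacent-gap swap-matching (swap-uncovered x∈ x∉) (swap-uncovered y∈ y∉) x≁y
          (λ z z≢x z≢y → swap-covers (λ z∈ → others z z∈ z≢x z≢y))

    partners-adjacent : ∀ {u v} → adj G u v ≡ true → v ≢ partner u →
                        adj G (partner u) (partner v) ≡ true
    partners-adjacent {u} {v} uv v≢u' with adj G (partner u) (partner v) in u'≁v'
    ... | true = refl
    ... | false = ⊥-elim (swap-gap u'∈ v'∈ u'∉ v'∉ u'≁v' others)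
      where
      open Swap (u ∷ v ∷ []) ((u , v) ∷ []) ((uv ∷ []) , ([] ∷ []))
                (here refl ∷ there (there (here refl)) ∷ [])
      u'∈ : partner u ∈ S
      u'∈ = there (here refl)
      v'∈ : partner v ∈ S
      v'∈ = there (there (there (here refl)))
      u'∉ : ¬ Covered G ((u , v) ∷ []) (partner u)
      u'∉ = All.All¬⇒¬Any (partner-≢ u ∷ (λ eq → v≢u' (≡.sym eq)) ∷ [])
      v'∉ : ¬ Covered G ((u , v) ∷ []) (partner v)
      v'∉ = All.All¬⇒¬Any ((λ eq → v≢u' (trans (≡.sym (partner-involutive v)) (cong partner eq))) ∷
                           partner-≢ v ∷ [])
      others : ∀ z → z ∈ S → z ≢ partner u → z ≢ partner v → Covered G ((u , v) ∷ []) z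
      others z (here refl) _ _ = here refl
      others z (there (here refl)) z≢u' _ = ⊥-elim (z≢u' refl)
      others z (there (there (here refl))) _ _ = there (here refl)
      others z (there (there (there (here refl)))) _ z≢v' = ⊥-elim (z≢v' refl)

    -- Exchange uu′, ff′ and ww′ for uf and u′w′, leaving exactly f′ and w uncovered.
    no-escape : ∀ {f u w} → adj G u f ≡ true → u ≢ partner f → adj G u w ≡ true →
                w ≢ f → w ≢ partner f → adj G w f ≡ false → adj G w (partner f) ≡ false → ⊥
    no-escape {f} {u} {w} uf u≢f' uw w≢f w≢f' w≁f w≁f' =
      swap-gap f'∈ w∈ f'∉ w∉ (trans (sym G (partner f) w) w≁f') others
      where
      f≢u' : f ≢ partner u
      f≢u' eq = u≢f' (trans (≡.sym (partner-involutive u)) (cong partner (≡.sym eq)))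
      w≢u' : w ≢ partner u
      w≢u' refl = case trans (≡.sym (partners-adjacent uf f≢u')) w≁f' of λ ()
      u'w' : adj G (partner u) (partner w) ≡ true
      u'w' = partners-adjacent uw w≢u'
      u≢w' : u ≢ partner w
      u≢w' eq = w≢u' (trans (≡.sym (partner-involutive w)) (cong partner (≡.sym eq)))
      f≢w' : f ≢ partner w
      f≢w' eq = w≢f' (trans (≡.sym (partner-involutive w)) (cong partner (≡.sym eq)))
      open Swap (f ∷ u ∷ w ∷ []) ((u , f) ∷ (partner u , partner w) ∷ [])
        (two-edge-matching G uf u'w'
          (((λ eq → partner-≢ u (≡.sym eq)) ∷ u≢w' ∷ []) ∷ (f≢u' ∷ f≢w' ∷ []) ∷ []))
        (there (there (here refl)) ∷ here refl ∷ there (there (there (here refl))) ∷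
         there (there (there (there (there (here refl))))) ∷ [])
      f'∈ : partner f ∈ S
      f'∈ = there (here refl)
      w∈ : w ∈ S
      w∈ = there (there (there (there (here refl))))
      f'∉ : ¬ Covered G ((u , f) ∷ (partner u , partner w) ∷ []) (partner f)
      f'∉ = All.All¬⇒¬Any ((λ eq → u≢f' (≡.sym eq)) ∷ partner-≢ f ∷
                           (λ eq → edge-irreflexive G uf (≡.sym (partner-injective eq))) ∷
                           (λ eq → w≢f (≡.sym (partner-injective eq))) ∷ [])
      w∉ : ¬ Covered G ((u , f) ∷ (partner u , partner w) ∷ []) w
      w∉ = All.All¬⇒¬Any ((λ eq → edge-irreflexive G uw (≡.sym eq)) ∷ w≢f ∷ w≢u' ∷
                          (λ eq → partner-≢ w (≡.sym eq)) ∷ [])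
      others : ∀ z → z ∈ S → z ≢ partner f → z ≢ w →
               Covered G ((u , f) ∷ (partner u , partner w) ∷ []) z
      others z (here refl) _ _ = there (here refl)
      others z (there (here refl)) z≢f' _ = ⊥-elim (z≢f' refl)
      others z (there (there (here refl))) _ _ = here refl
      others z (there (there (there (here refl)))) _ _ = there (there (here refl))
      others z (there (there (there (there (here refl))))) _ z≢w = ⊥-elim (z≢w refl)
      others z (there (there (there (there (there (here refl)))))) _ _ =
        there (there (there (here refl)))

    perfect-through : ∀ {a b} → adj G a b ≡ true →
                      Σ (List (Edge n)) λ P' → IsPerfectMatching G P' × EdgeIn G (a , b) P'
    perfect-through {a} {b} ab with b Fin.≟ partner a
    ... | yes refl = P , perfect , partner-edge a
    ... | no b≢a' =
      N , swap-perfect covers , lose (∈-++⁺ʳ (filter outside? P) (here refl)) (SameEdge-refl G)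
      where
      a≢b' : a ≢ partner b
      a≢b' eq = b≢a' (trans (≡.sym (partner-involutive b)) (cong partner (≡.sym eq)))
      open Swap (a ∷ b ∷ []) ((a , b) ∷ (partner a , partner b) ∷ [])
        (two-edge-matching G ab (partners-adjacent ab b≢a')
          (((λ eq → partner-≢ a (≡.sym eq)) ∷ a≢b' ∷ []) ∷
           (b≢a' ∷ (λ eq → partner-≢ b (≡.sym eq)) ∷ []) ∷ []))
        (here refl ∷ there (there (here refl)) ∷
         there (here refl) ∷ there (there (there (here refl))) ∷ [])
      covers : ∀ z → z ∈ S → Covered G ((a , b) ∷ (partner a , partner b) ∷ []) z
      covers z (here refl) = here refl
      covers z (there (here refl)) = there (there (here refl))
      covers z (there (there (here refl))) = there (here refl)
      covers z (there (there (there (here refl)))) = there (there (there (here refl)))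

    Near : Fin n → Fin n → Set
    Near e z = z ≡ e ⊎ z ≡ partner e ⊎ adj G z e ≡ true ⊎ adj G z (partner e) ≡ true

    near-partner : ∀ {e z} → Near e z → Near (partner e) z
    near-partner {e} (inj₁ p) = inj₂ (inj₁ (trans p (≡.sym (partner-involutive e))))
    near-partner (inj₂ (inj₁ p)) = inj₁ p
    near-partner {e} (inj₂ (inj₂ (inj₁ a))) =
      inj₂ (inj₂ (inj₂ (subst (λ t → adj G _ t ≡ true) (≡.sym (partner-involutive e)) a)))
    near-partner (inj₂ (inj₂ (inj₂ a))) = inj₂ (inj₂ (inj₁ a))

    adjacent-step : ∀ {f u w} → adj G u f ≡ true → u ≢ partner f → adj G u w ≡ true → Near f w
    adjacent-step {f} {u} {w} uf u≢f' uw
      with w Fin.≟ f | w Fin.≟ partner f | adj G w f in w~f | adj G w (partner f) in w~f'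
    ... | yes p | _ | _ | _ = inj₁ p
    ... | no _ | yes p | _ | _ = inj₂ (inj₁ p)
    ... | no _ | no _ | true | _ = inj₂ (inj₂ (inj₁ refl))
    ... | no _ | no _ | false | true = inj₂ (inj₂ (inj₂ refl))
    ... | no w≢f | no w≢f' | false | false = ⊥-elim (no-escape uf u≢f' uw w≢f w≢f' w~f w~f')

    near-closed : ∀ {e u w} → Near e u → adj G u w ≡ true → Near e w
    near-closed (inj₁ refl) uw = inj₂ (inj₂ (inj₁ (edge-sym G uw)))
    near-closed (inj₂ (inj₁ refl)) uw = inj₂ (inj₂ (inj₂ (edge-sym G uw)))
    near-closed {e} {u} (inj₂ (inj₂ (inj₁ ue))) uw with u Fin.≟ partner e
    ... | yes refl = inj₂ (inj₂ (inj₂ (edge-sym G uw)))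
    ... | no u≢e' = adjacent-step ue u≢e' uw
    near-closed {e} {u} (inj₂ (inj₂ (inj₂ ue'))) uw with u Fin.≟ e
    ... | yes refl = inj₂ (inj₂ (inj₁ (edge-sym G uw)))
    ... | no u≢e = subst (λ t → Near t _) (partner-involutive e)
                     (near-partner (adjacent-step ue' (λ eq → u≢e (trans eq (partner-involutive e))) uw))

    reach-near : ∀ {e u z} → Reachable G u z → Near e u → Near e z
    reach-near here near = near
    reach-near (step uv r) near = reach-near r (near-closed near uv)

  connected⇒induced-matching-≤1 : Connected G → ∀ {P} → IsPerfectMatching G P →
                                  ∀ {M} → IsInducedMatching G M → length M ≤ 1
  connected⇒induced-matching-≤1 _ _ {[]} _ = z≤n
  connected⇒induced-matching-≤1 _ _ {_ ∷ []} _ = ≤-refl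
  connected⇒induced-matching-≤1 connected {P} perfect {(a , b) ∷ (c , d) ∷ _}
      ((ab ∷ _ , (ab#cd ∷ _) ∷ _) , (induced ∷ _) ∷ _)
    with PerfectMatching.perfect-through P perfect ab
  ... | P' , perfect' , ab∈P' = ⊥-elim (far-apart (reach-near (connected a c) (inj₁ refl)))
    where
    open PerfectMatching P' perfect'
    b≡a' : b ≡ partner a
    b≡a' = partner-unique ab∈P'
    far-apart : Near a c → ⊥
    far-apart (inj₁ c≡a) = ab#cd (c , inj₁ c≡a , inj₁ refl)
    far-apart (inj₂ (inj₁ c≡a')) = ab#cd (c , inj₂ (trans c≡a' (≡.sym b≡a')) , inj₁ refl)
    far-apart (inj₂ (inj₂ (inj₁ ca))) =
      induced (c , a) ca ((a , inj₂ refl , inj₁ refl) , (c , inj₁ refl , inj₁ refl))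
    far-apart (inj₂ (inj₂ (inj₂ ca'))) =
      induced (c , b) (subst (λ t → adj G c t ≡ true) (≡.sym b≡a') ca')
        ((b , inj₂ refl , inj₂ refl) , (c , inj₁ refl , inj₁ refl))

-- Lower bounds on the order

matching-number⇒order≥ : ∀ {n} (G : Graph n) {p q r} → Realizes G p q r → 2 * r ≤ n
matching-number⇒order≥ G (_ , _ , _ , (_ , matching , refl) , _) =
  matching-order-bound G matching [] []

induced-pair⇒order> : ∀ {n} (G : Graph n) {p r} → 2 ≤ p → Realizes G p r r → suc (2 * r) ≤ n
induced-pair⇒order> {n} G 2≤p
  (connected , ((_ , induced , refl) , _) , ((M₀ , maximal₀ , refl) , minimal) , _)
  with suc (2 * length M₀) ≤? n
... | yes 2r<n = 2r<n
... | no 2r≮n = ⊥-elim (<⇒≱ 2≤p (RandomlyMatchable.connected⇒induced-matching-≤1 G perfect connected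
                                    (proj₁ maximal₀ , perfect maximal₀) induced))
  where
  perfect : ∀ {M} → IsMaximalMatching G M → ∀ z → Covered G M z
  perfect {M} maximal z with covered? G M z
  ... | yes z-covered = z-covered
  ... | no z∉ = ⊥-elim (<⇒≱ (matching-order-bound G (proj₁ maximal) ([] ∷ []) (z∉ ∷ []))
                            (≤-trans (≮⇒≥ 2r≮n) (*-monoʳ-≤ 2 (minimal M maximal))))

Endpoint : ℕ → ℕ × ℕ → Set
Endpoint a (x , y) = a ≡ x ⊎ a ≡ y

module OnNaturals {R : ℕ → ℕ → Set} (R? : ∀ x y → Dec (R x y))
                  (R-sym : ∀ {x y} → R x y → R y x) (R-irrefl : ∀ {x} → ¬ R x x) (N : ℕ) where

  does-sym : ∀ x y → does (R? x y) ≡ does (R? y x)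
  does-sym x y with R? x y | R? y x
  ... | yes _ | yes _ = refl
  ... | no _ | no _ = refl
  ... | yes r | no ¬r = ⊥-elim (¬r (R-sym r))
  ... | no ¬r | yes r = ⊥-elim (¬r (R-sym r))

  graph : Graph (suc N)
  graph = record
    { adj = λ u v → does (R? (toℕ u) (toℕ v))
    ; sym = λ u v → does-sym (toℕ u) (toℕ v)
    ; irrefl = λ u → dec-false (R? (toℕ u) (toℕ u)) R-irrefl
    }

  edge⇒R : ∀ {u v} → adj graph u v ≡ true → R (toℕ u) (toℕ v)
  edge⇒R {u} {v} e with R? (toℕ u) (toℕ v)
  ... | yes r = r

  R⇒edge : ∀ {u v} → R (toℕ u) (toℕ v) → adj graph u v ≡ true
  R⇒edge = dec-true (R? _ _)

  -- Saturates at K; only ever applied to arguments below suc K.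
  clamp : ∀ {K} → ℕ → Fin (suc K)
  clamp {zero} _ = Fin.zero
  clamp {suc K} zero = Fin.zero
  clamp {suc K} (suc x) = Fin.suc (clamp x)

  toℕ-clamp : ∀ {K x} → x < suc K → toℕ (clamp {K} x) ≡ x
  toℕ-clamp {zero} (s≤s z≤n) = refl
  toℕ-clamp {suc K} {zero} _ = refl
  toℕ-clamp {suc K} {suc x} (s≤s x<) = cong suc (toℕ-clamp x<)

  clamp-toℕ : ∀ {K} (z : Fin (suc K)) → clamp (toℕ z) ≡ z
  clamp-toℕ {zero} Fin.zero = refl
  clamp-toℕ {suc K} Fin.zero = refl
  clamp-toℕ {suc K} (Fin.suc z) = cong Fin.suc (clamp-toℕ z)

  clampEdge : ℕ × ℕ → Edge (suc N)
  clampEdge (x , y) = clamp x , clamp y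

  Bounded : ℕ × ℕ → Set
  Bounded (x , y) = x < suc N × y < suc N

  endpoint-clamp : ∀ {z e} → Bounded e → Incident graph z (clampEdge e) → Endpoint (toℕ z) e
  endpoint-clamp (x< , _) (inj₁ refl) = inj₁ (toℕ-clamp x<)
  endpoint-clamp (_ , y<) (inj₂ refl) = inj₂ (toℕ-clamp y<)

  covered-clamp : ∀ {M e z} → clampEdge e ∈ M → Endpoint (toℕ z) e → Covered graph M z
  covered-clamp {z = z} e∈M end = covered-by graph e∈M (incident end)
    where
    incident : ∀ {e} → Endpoint (toℕ z) e → Incident graph z (clampEdge e)
    incident (inj₁ refl) = inj₁ (≡.sym (clamp-toℕ z))
    incident (inj₂ refl) = inj₂ (≡.sym (clamp-toℕ z))

  edge-clamp : ∀ {x y} → Bounded (x , y) → R x y → IsEdge graph (clampEdge (x , y))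
  edge-clamp (x< , y<) r = R⇒edge (subst₂ R (≡.sym (toℕ-clamp x<)) (≡.sym (toℕ-clamp y<)) r)

  DisjointPairs : ℕ × ℕ → ℕ × ℕ → Set
  DisjointPairs e f = ∀ {a} → Endpoint a e → ¬ Endpoint a f

  disjoint-clamp : ∀ {e f} → Bounded e → Bounded f → DisjointPairs e f →
                   ¬ Meet graph (clampEdge e) (clampEdge f)
  disjoint-clamp be bf e#f (z , i , j) = e#f (endpoint-clamp be i) (endpoint-clamp bf j)

  Unlinked : ℕ × ℕ → ℕ × ℕ → Set
  Unlinked e f = ∀ {a b} → Endpoint a e → Endpoint b f → ¬ R a b

  unlinked-clamp : ∀ {e f} → Bounded e → Bounded f → DisjointPairs e f → Unlinked e f →
                   ∀ g → IsEdge graph g → ¬ (Meet graph g (clampEdge e) × Meet graph g (clampEdge f))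
  unlinked-clamp be bf e#f e≁f g g∈E ((_ , inj₁ refl , i) , (_ , inj₁ refl , j)) =
    e#f (endpoint-clamp be i) (endpoint-clamp bf j)
  unlinked-clamp be bf e#f e≁f g g∈E ((_ , inj₂ refl , i) , (_ , inj₂ refl , j)) =
    e#f (endpoint-clamp be i) (endpoint-clamp bf j)
  unlinked-clamp be bf e#f e≁f g g∈E ((_ , inj₂ refl , i) , (_ , inj₁ refl , j)) =
    e≁f (endpoint-clamp be i) (endpoint-clamp bf j) (edge⇒R (edge-sym graph g∈E))
  unlinked-clamp be bf e#f e≁f g g∈E ((_ , inj₁ refl , i) , (_ , inj₂ refl , j)) =
    e≁f (endpoint-clamp be i) (endpoint-clamp bf j) (edge⇒R g∈E)

  IsEdgePair : ℕ × ℕ → Set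
  IsEdgePair e = Bounded e × R (proj₁ e) (proj₂ e)

  module _ (f : ℕ → ℕ × ℕ) (c : ℕ) (edges : ∀ {i} → i < c → IsEdgePair (f i)) where

    edges-applyUpTo : All (IsEdge graph) (applyUpTo (clampEdge ∘ f) c)
    edges-applyUpTo = All.applyUpTo⁺₁ (clampEdge ∘ f) c λ i<c →
      edge-clamp (proj₁ (edges i<c)) (proj₂ (edges i<c))

    matching-applyUpTo : (∀ {i j} → i < j → j < c → DisjointPairs (f i) (f j)) →
                         IsMatching graph (applyUpTo (clampEdge ∘ f) c)
    matching-applyUpTo disjoint =
      edges-applyUpTo , AllPairs.applyUpTo⁺₁ (clampEdge ∘ f) c λ i<j j<c →
        disjoint-clamp (proj₁ (edges (<-trans i<j j<c))) (proj₁ (edges j<c)) (disjoint i<j j<c)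

    induced-applyUpTo : (∀ {i j} → i < j → j < c → DisjointPairs (f i) (f j) × Unlinked (f i) (f j)) →
                        IsInducedMatching graph (applyUpTo (clampEdge ∘ f) c)
    induced-applyUpTo separated =
      matching-applyUpTo (λ i<j j<c → proj₁ (separated i<j j<c)) ,
      AllPairs.applyUpTo⁺₁ (clampEdge ∘ f) c λ i<j j<c →
        unlinked-clamp (proj₁ (edges (<-trans i<j j<c))) (proj₁ (edges j<c))
                       (proj₁ (separated i<j j<c)) (proj₂ (separated i<j j<c))

    cross-disjoint-applyUpTo : ∀ (g : ℕ → ℕ × ℕ) d → (∀ {j} → j < d → Bounded (g j)) →
                               (∀ {i j} → i < c → j < d → DisjointPairs (f i) (g j)) →
                               All (λ e → All (λ e' → ¬ Meet graph e e') (applyUpTo (clampEdge ∘ g) d))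
                                   (applyUpTo (clampEdge ∘ f) c)
    cross-disjoint-applyUpTo g d bounded disjoint =
      All.applyUpTo⁺₁ (clampEdge ∘ f) c λ i<c → All.applyUpTo⁺₁ (clampEdge ∘ g) d λ j<d →
        disjoint-clamp (proj₁ (edges i<c)) (bounded j<d) (disjoint i<c j<d)

-- The extremal graphs

pair : ℕ → ℕ × ℕ
pair h = h + h , suc (h + h)

⌊pair/2⌋ : ∀ {a h} → Endpoint a (pair h) → ⌊ a /2⌋ ≡ h
⌊pair/2⌋ {h = h} (inj₁ refl) = ≡.sym (n≡⌊n+n/2⌋ h)
⌊pair/2⌋ {h = h} (inj₂ refl) = ≡.sym (n≡⌈n+n/2⌉ h)

in-pair-of-half : ∀ x → Endpoint x (pair ⌊ x /2⌋)
in-pair-of-half zero = inj₁ refl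
in-pair-of-half (suc zero) = inj₂ refl
in-pair-of-half (suc (suc x)) with in-pair-of-half x
... | inj₁ eq = inj₁ (cong suc (trans (cong suc eq) (≡.sym (+-suc ⌊ x /2⌋ ⌊ x /2⌋))))
... | inj₂ eq = inj₂ (cong (suc ∘ suc) (trans eq (≡.sym (+-suc ⌊ x /2⌋ ⌊ x /2⌋))))

sibling : ℕ → ℕ
sibling zero = 1
sibling (suc zero) = 0
sibling (suc (suc x)) = suc (suc (sibling x))

⌊sibling/2⌋ : ∀ x → ⌊ sibling x /2⌋ ≡ ⌊ x /2⌋
⌊sibling/2⌋ zero = refl
⌊sibling/2⌋ (suc zero) = refl
⌊sibling/2⌋ (suc (suc x)) = cong suc (⌊sibling/2⌋ x)

sibling-involutive : ∀ x → sibling (sibling x) ≡ x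
sibling-involutive zero = refl
sibling-involutive (suc zero) = refl
sibling-involutive (suc (suc x)) = cong (suc ∘ suc) (sibling-involutive x)

sibling-≢ : ∀ x → sibling x ≢ x
sibling-≢ (suc (suc x)) eq = sibling-≢ x (suc-injective (suc-injective eq))

same-half : ∀ x y → ⌊ x /2⌋ ≡ ⌊ y /2⌋ → y ≡ x ⊎ y ≡ sibling x
same-half zero zero _ = inj₁ refl
same-half zero (suc zero) _ = inj₂ refl
same-half (suc zero) zero _ = inj₂ refl
same-half (suc zero) (suc zero) _ = inj₁ refl
same-half (suc (suc x)) (suc (suc y)) eq with same-half x y (suc-injective eq)
... | inj₁ p = inj₁ (cong (suc ∘ suc) p)
... | inj₂ p = inj₂ (cong (suc ∘ suc) p)

<⇒⌊/2⌋< : ∀ {x q} → x < q + q → ⌊ x /2⌋ < q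
<⇒⌊/2⌋< {x} {q} x< = subst (suc ⌊ x /2⌋ ≤_) (≡.sym (n≡⌈n+n/2⌉ q)) (⌊n/2⌋-mono (s≤s x<))

⌊/2⌋<⇒< : ∀ {x q} → ⌊ x /2⌋ < q → x < q + q
⌊/2⌋<⇒< {x} {q} h< = ≰⇒> λ q+q≤x →
  <⇒≱ h< (subst (_≤ ⌊ x /2⌋) (≡.sym (n≡⌊n+n/2⌋ q)) (⌊n/2⌋-mono q+q≤x))

double≤odd⇒≤ : ∀ {k r} → k + k ≤ suc (r + r) → k ≤ r
double≤odd⇒≤ {k} {r} le =
  subst₂ _≤_ (≡.sym (n≡⌊n+n/2⌋ k)) (≡.sym (n≡⌈n+n/2⌉ r)) (⌊n/2⌋-mono le)

module Construction (q p : ℕ) (1≤p : 1 ≤ p) (p≤q : p ≤ q) where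

  InA : ℕ → Set
  InA x = x < q + q

  class : ℕ → ℕ
  class x = ⌊ x /2⌋ ∸ (q ∸ p)

  Adjacent : ℕ → ℕ → Set
  Adjacent x y = x ≢ y × (InA x ⊎ InA y) × (InA x → InA y → class x ≡ class y)

  adjacent? : ∀ x y → Dec (Adjacent x y)
  adjacent? x y = ¬? (x ≟ y) ×-dec ((x <? q + q) ⊎-dec (y <? q + q)) ×-dec
                  ((x <? q + q) →-dec ((y <? q + q) →-dec (class x ≟ class y)))

  Adjacent-sym : ∀ {x y} → Adjacent x y → Adjacent y x
  Adjacent-sym (x≢y , some , same) =
    (λ eq → x≢y (≡.sym eq)) , Sum.swap some , λ y∈A x∈A → ≡.sym (same x∈A y∈A)

  Adjacent-irrefl : ∀ {x} → ¬ Adjacent x x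
  Adjacent-irrefl (x≢x , _) = x≢x refl

  inner-adjacent : ∀ {x y} → x ≢ y → InA x → InA y → class x ≡ class y → Adjacent x y
  inner-adjacent x≢y x∈A _ same = x≢y , inj₁ x∈A , λ _ _ → same

  across-adjacent : ∀ {x y} → InA x → ¬ InA y → Adjacent x y
  across-adjacent x∈A y∉A = (λ { refl → y∉A x∈A }) , inj₁ x∈A , λ _ y∈A → ⊥-elim (y∉A y∈A)

  class-< : ∀ {x} → InA x → class x < p
  class-< {x} x∈A with q ∸ p ≤? ⌊ x /2⌋
  ... | yes d≤h = subst (class x <_) (m∸[m∸n]≡n p≤q) (∸-monoˡ-< (<⇒⌊/2⌋< x∈A) d≤h)
  ... | no h≱d = subst (_< p) (≡.sym (m≤n⇒m∸n≡0 (<⇒≤ (≰⇒> h≱d)))) 1≤p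

  class≢0⇒offset≤ : ∀ {x} → class x ≢ 0 → q ∸ p ≤ ⌊ x /2⌋
  class≢0⇒offset≤ c≢0 = ≮⇒≥ λ h<d → c≢0 (m≤n⇒m∸n≡0 (<⇒≤ h<d))

  same-positive-class : ∀ {x y} → class x ≡ class y → class x ≢ 0 → ⌊ x /2⌋ ≡ ⌊ y /2⌋
  same-positive-class same c≢0 =
    ∸-cancelʳ-≡ (class≢0⇒offset≤ c≢0) (class≢0⇒offset≤ (λ c≡0 → c≢0 (trans same c≡0))) same

  sibling-in-A : ∀ {x} → InA x → InA (sibling x)
  sibling-in-A {x} x∈A = ⌊/2⌋<⇒< (subst (_< q) (≡.sym (⌊sibling/2⌋ x)) (<⇒⌊/2⌋< x∈A))

  class-sibling : ∀ x → class (sibling x) ≡ class x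
  class-sibling x = cong (_∸ (q ∸ p)) (⌊sibling/2⌋ x)

  pair-in-A : ∀ {a h} → h < q → Endpoint a (pair h) → InA a
  pair-in-A h<q end = ⌊/2⌋<⇒< (subst (_< q) (≡.sym (⌊pair/2⌋ end)) h<q)

  pair-adjacent : ∀ {h} → h < q → Adjacent (h + h) (suc (h + h))
  pair-adjacent {h} h<q =
    inner-adjacent (λ eq → 1+n≢n (≡.sym eq)) (pair-in-A h<q (inj₁ refl)) (pair-in-A h<q (inj₂ refl))
      (cong (_∸ (q ∸ p)) (trans (⌊pair/2⌋ {h = h} (inj₁ refl)) (≡.sym (⌊pair/2⌋ {h = h} (inj₂ refl)))))

  module Realization (t N : ℕ) (size : suc N ≡ q + q + t) where

    open OnNaturals adjacent? Adjacent-sym Adjacent-irrefl N public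

    bounded : ∀ {x} → x < q + q + t → x < suc N
    bounded {x} = subst (x <_) (≡.sym size)

    A-bounded : ∀ {x} → InA x → x < suc N
    A-bounded x∈A = bounded (<-≤-trans x∈A (m≤m+n _ t))

    pair-edge : ∀ {h} → h < q → IsEdgePair (pair h)
    pair-edge h<q = (A-bounded (pair-in-A h<q (inj₁ refl)) , A-bounded (pair-in-A h<q (inj₂ refl))) ,
                    pair-adjacent h<q

    pairs-disjoint : ∀ {h h'} → h ≢ h' → DisjointPairs (pair h) (pair h')
    pairs-disjoint h≢h' e e' = h≢h' (trans (≡.sym (⌊pair/2⌋ e)) (⌊pair/2⌋ e'))

    pairs-unlinked : ∀ {h h'} → q ∸ p ≤ h → q ∸ p ≤ h' → h ≢ h' → h < q → h' < q →
                     Unlinked (pair h) (pair h')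
    pairs-unlinked d≤h d≤h' h≢h' h<q h'<q e e' (_ , _ , same) =
      h≢h' (∸-cancelʳ-≡ d≤h d≤h'
        (subst₂ (λ a b → a ∸ (q ∸ p) ≡ b ∸ (q ∸ p)) (⌊pair/2⌋ e) (⌊pair/2⌋ e')
                (same (pair-in-A h<q e) (pair-in-A h'<q e'))))

    spoke : ℕ → ℕ × ℕ
    spoke j = q + q + j , j

    spoke-edge : ∀ {j} → j < q + q → j < t → IsEdgePair (spoke j)
    spoke-edge j∈A j<t = (bounded (+-monoʳ-< (q + q) j<t) , A-bounded j∈A) ,
                         Adjacent-sym (across-adjacent j∈A (m+n≮m (q + q) _))

    spokes-disjoint : ∀ {j j'} → j ≢ j' → j < q + q → j' < q + q → DisjointPairs (spoke j) (spoke j')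
    spokes-disjoint j≢j' _ _ (inj₁ refl) (inj₁ eq) = j≢j' (+-cancelˡ-≡ (q + q) _ _ eq)
    spokes-disjoint {j} _ _ j'∈A (inj₁ refl) (inj₂ eq) = m+n≮m (q + q) j (subst (_< q + q) (≡.sym eq) j'∈A)
    spokes-disjoint {j' = j'} _ j∈A _ (inj₂ refl) (inj₁ eq) = m+n≮m (q + q) j' (subst (_< q + q) eq j∈A)
    spokes-disjoint j≢j' _ _ (inj₂ refl) (inj₂ eq) = j≢j' eq

    spoke-pair-disjoint : ∀ {m j h} → j < m + m → m ≤ h → h < q → DisjointPairs (spoke j) (pair h)
    spoke-pair-disjoint {j = j} _ _ h<q (inj₁ refl) e = m+n≮m (q + q) j (pair-in-A h<q e)
    spoke-pair-disjoint {m} {j} {h} j<2m m≤h _ (inj₂ refl) e =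
      <⇒≱ (<⇒⌊/2⌋< j<2m) (subst (m ≤_) (≡.sym (⌊pair/2⌋ e)) m≤h)

    inducedPairs : List (Edge (suc N))
    inducedPairs = applyUpTo (clampEdge ∘ pair ∘ (q ∸ p +_)) p

    inducedPairs-induced : IsInducedMatching graph inducedPairs
    inducedPairs-induced = induced-applyUpTo (pair ∘ (q ∸ p +_)) p (pair-edge ∘ shifted) λ i<j j<p →
      let i≢j = λ eq → <⇒≢ i<j (+-cancelˡ-≡ (q ∸ p) _ _ eq) in
      pairs-disjoint i≢j ,
      pairs-unlinked (m≤m+n (q ∸ p) _) (m≤m+n (q ∸ p) _) i≢j (shifted (<-trans i<j j<p)) (shifted j<p)
      where
      shifted : ∀ {i} → i < p → q ∸ p + i < q
      shifted {i} i<p = subst (q ∸ p + i <_) (m∸n+n≡m p≤q) (+-monoʳ-< (q ∸ p) i<p)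

    A-end : Edge (suc N) → Fin (suc N)
    A-end (u , v) with toℕ u <? q + q
    ... | yes _ = u
    ... | no _ = v

    A-end-incident : ∀ e → Incident graph (A-end e) e
    A-end-incident (u , v) with toℕ u <? q + q
    ... | yes _ = inj₁ refl
    ... | no _ = inj₂ refl

    A-end-in-A : ∀ {e} → IsEdge graph e → InA (toℕ (A-end e))
    A-end-in-A {u , v} uv with toℕ u <? q + q | proj₁ (proj₂ (edge⇒R uv))
    ... | yes u∈A | _ = u∈A
    ... | no u∉A | inj₁ u∈A = ⊥-elim (u∉A u∈A)
    ... | no _ | inj₂ v∈A = v∈A

    edgeClass : Edge (suc N) → ℕ
    edgeClass e = class (toℕ (A-end e))

    induced-edgeClass-distinct : ∀ {e f} → IsEdge graph e → IsEdge graph f →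
      ¬ Meet graph e f × (∀ g → IsEdge graph g → ¬ (Meet graph g e × Meet graph g f)) →
      edgeClass e ≢ edgeClass f
    induced-edgeClass-distinct {e} {f} e∈E f∈E (e#f , induced) same =
      induced (A-end e , A-end f) (R⇒edge (inner-adjacent distinct (A-end-in-A e∈E) (A-end-in-A f∈E) same))
        ((A-end e , inj₁ refl , A-end-incident e) , (A-end f , inj₂ refl , A-end-incident f))
      where
      distinct : toℕ (A-end e) ≢ toℕ (A-end f)
      distinct eq = e#f (A-end e , A-end-incident e ,
                         subst (λ x → Incident graph x f) (≡.sym (Fin.toℕ-injective eq)) (A-end-incident f))

    induced-bound : ∀ {M} → IsInducedMatching graph M → length M ≤ p
    induced-bound {M} ((edges , disjoint) , induced) = subst (_≤ p) (length-map edgeClass M)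
      (Unique-bounded⇒length≤
        (AllPairs.map⁺ (AllPairs.map (λ (e∈E , f∈E , separated) →
                                        induced-edgeClass-distinct e∈E f∈E separated)
                                     (AllPairs-annotate edges (AllPairs.zip (disjoint , induced)))))
        (All.map⁺ (All.map (class-< ∘ A-end-in-A) edges)))

    allPairs : List (Edge (suc N))
    allPairs = applyUpTo (clampEdge ∘ pair) q

    allPairs-matching : IsMatching graph allPairs
    allPairs-matching = matching-applyUpTo pair q pair-edge λ i<j _ → pairs-disjoint (<⇒≢ i<j)

    allPairs-covers-A : ∀ z → InA (toℕ z) → Covered graph allPairs z
    allPairs-covers-A z z∈A =
      covered-clamp (∈-applyUpTo⁺ (clampEdge ∘ pair) (<⇒⌊/2⌋< z∈A)) (in-pair-of-half (toℕ z))

    allPairs-maximal : IsMaximalMatching graph allPairs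
    allPairs-maximal = vertexCover⇒maximal graph allPairs-matching λ u v uv →
      Sum.map (allPairs-covers-A u) (allPairs-covers-A v) (proj₁ (proj₂ (edge⇒R uv)))

    B-vertices : List (Fin (suc N))
    B-vertices = applyUpTo (λ j → clamp (q + q + j)) t

    B-vertices-complete : ∀ z → ¬ InA (toℕ z) → z ∈ B-vertices
    B-vertices-complete z z∉A = subst (_∈ B-vertices) (trans (cong clamp Q+j≡z) (clamp-toℕ z))
      (∈-applyUpTo⁺ (λ j → clamp (q + q + j)) (+-cancelˡ-< (q + q) _ t
        (subst₂ _<_ (≡.sym Q+j≡z) size (Fin.toℕ<n z))))
      where
      Q+j≡z : q + q + (toℕ z ∸ (q + q)) ≡ toℕ z
      Q+j≡z = m+[n∸m]≡n (≮⇒≥ z∉A)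

    module MaximalMatching {M : List (Edge (suc N))} (maximal : IsMaximalMatching graph M) where

      fromB : Fin (suc N) → Fin (suc N)
      fromB b with covered? graph M b
      ... | yes c = clamp (sibling (toℕ (mate graph c)))
      ... | no _ = b

      fromB-uncovered : ∀ {b} → ¬ Covered graph M b → fromB b ≡ b
      fromB-uncovered {b} b∉ with covered? graph M b
      ... | yes c = ⊥-elim (b∉ c)
      ... | no _ = refl

      fromB-matched : ∀ {b w} → EdgeIn graph (b , w) M → fromB b ≡ clamp (sibling (toℕ w))
      fromB-matched {b} bw with covered? graph M b
      ... | yes c =
        cong (clamp ∘ sibling ∘ toℕ) (matching-mate-unique graph (proj₁ maximal) (mate-edge graph c) bw)
      ... | no b∉ = ⊥-elim (b∉ (EdgeIn⇒covered graph bw))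

      Lonely : Fin (suc N) → Set
      Lonely z = ¬ Covered graph M z × InA (toℕ z) × class (toℕ z) ≡ 0

      lonely? : ∀ z → Dec (Lonely z)
      lonely? z = ¬? (covered? graph M z) ×-dec (toℕ z <? q + q ×-dec class (toℕ z) ≟ 0)

      -- The uncovered vertex of class 0 if there is one, and an arbitrary vertex otherwise.
      lonely : Fin (suc N)
      lonely with Fin.any? lonely?
      ... | yes (z , _) = z
      ... | no _ = Fin.zero

      lonely-unique : ∀ {z} → Lonely z → lonely ≡ z
      lonely-unique {z} (z∉ , z∈A , c≡0) with Fin.any? lonely?
      ... | no none = ⊥-elim (none (z , z∉ , z∈A , c≡0))
      ... | yes (y , y∉ , y∈A , c'≡0) with y Fin.≟ z
      ...   | yes y≡z = y≡z
      ...   | no y≢z with maximal⇒vertexCover graph maximal y z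
                           (R⇒edge (inner-adjacent (y≢z ∘ Fin.toℕ-injective) y∈A z∈A (trans c'≡0 (≡.sym c≡0))))
      ...     | inj₁ y-covered = ⊥-elim (y∉ y-covered)
      ...     | inj₂ z-covered = ⊥-elim (z∉ z-covered)

      module _ {z} (z∉ : ¬ Covered graph M z) (z∈A : InA (toℕ z)) (c≢0 : class (toℕ z) ≢ 0) where

        z' : Fin (suc N)
        z' = clamp (sibling (toℕ z))

        toℕ-z' : toℕ z' ≡ sibling (toℕ z)
        toℕ-z' = toℕ-clamp (A-bounded (sibling-in-A z∈A))

        z'∈A : InA (toℕ z')
        z'∈A = subst InA (≡.sym toℕ-z') (sibling-in-A z∈A)

        sibling-covered : Covered graph M z'
        sibling-covered with maximal⇒vertexCover graph maximal z z' (R⇒edge z~z')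
          where
          z~z' : Adjacent (toℕ z) (toℕ z')
          z~z' = subst (Adjacent (toℕ z)) (≡.sym toℕ-z')
            (inner-adjacent (sibling-≢ _ ∘ ≡.sym) z∈A (sibling-in-A z∈A) (≡.sym (class-sibling _)))
        ... | inj₁ z-covered = ⊥-elim (z∉ z-covered)
        ... | inj₂ z'-covered = z'-covered

        sibling-mate-outside-A : ∀ {w} → EdgeIn graph (z' , w) M → ¬ InA (toℕ w)
        sibling-mate-outside-A {w} z'w w∈A with same-half (toℕ z) (toℕ w) halves
          where
          z'w-edge : IsEdge graph (z' , w)
          z'w-edge = EdgeIn⇒IsEdge graph (proj₁ (proj₁ maximal)) z'w
          c'≢0 : class (toℕ z') ≢ 0
          c'≢0 = c≢0 ∘ trans (≡.sym (trans (cong class toℕ-z') (class-sibling _)))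
          halves : ⌊ toℕ z /2⌋ ≡ ⌊ toℕ w /2⌋
          halves = trans (≡.sym (trans (cong ⌊_/2⌋ toℕ-z') (⌊sibling/2⌋ _)))
                         (same-positive-class (proj₂ (proj₂ (edge⇒R z'w-edge)) z'∈A w∈A) c'≢0)
        ... | inj₁ w≡z =
          z∉ (subst (Covered graph M) (Fin.toℕ-injective w≡z) (EdgeIn⇒covered graph (EdgeIn-flip graph z'w)))
        ... | inj₂ w≡s = edge-irreflexive graph (EdgeIn⇒IsEdge graph (proj₁ (proj₁ maximal)) z'w)
                           (Fin.toℕ-injective (trans toℕ-z' (≡.sym w≡s)))

        sibling-rescued : z ∈ map fromB B-vertices
        sibling-rescued = subst (_∈ map fromB B-vertices) fromB-w≡z
          (∈-map⁺ fromB (B-vertices-complete w (sibling-mate-outside-A z'w)))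
          where
          w : Fin (suc N)
          w = mate graph sibling-covered
          z'w : EdgeIn graph (z' , w) M
          z'w = mate-edge graph sibling-covered
          fromB-w≡z : fromB w ≡ z
          fromB-w≡z = begin
            fromB w                      ≡⟨ fromB-matched (EdgeIn-flip graph z'w) ⟩
            clamp (sibling (toℕ z'))     ≡⟨ cong (clamp ∘ sibling) toℕ-z' ⟩
            clamp (sibling (sibling (toℕ z))) ≡⟨ cong clamp (sibling-involutive (toℕ z)) ⟩
            clamp (toℕ z)                ≡⟨ clamp-toℕ z ⟩
            z                            ∎
            where open ≡.≡-Reasoning

      listing : List (Fin (suc N))
      listing = endpoints graph M ++ lonely ∷ map fromB B-vertices

      listed : ∀ z → z ∈ listing
      listed z with covered? graph M z
      ... | yes z-covered = ∈-++⁺ˡ z-covered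
      ... | no z∉ with toℕ z <? q + q
      ...   | no z∉A = ∈-++⁺ʳ _ (there (subst (_∈ map fromB B-vertices) (fromB-uncovered z∉)
                                         (∈-map⁺ fromB (B-vertices-complete z z∉A))))
      ...   | yes z∈A with class (toℕ z) ≟ 0
      ...     | yes c≡0 = ∈-++⁺ʳ _ (here (≡.sym (lonely-unique (z∉ , z∈A , c≡0))))
      ...     | no c≢0 = ∈-++⁺ʳ _ (there (sibling-rescued z∉ z∈A c≢0))

      length-listing : length listing ≡ suc (length M + length M) + t
      length-listing = begin
        length listing
          ≡⟨ length-++ (endpoints graph M) ⟩
        length (endpoints graph M) + suc (length (map fromB B-vertices))
          ≡⟨ cong₂ (λ a b → a + suc b) (length-endpoints graph M)
                   (trans (length-map fromB B-vertices) (length-applyUpTo _ t)) ⟩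
        2 * length M + suc t
          ≡⟨ +-suc (2 * length M) t ⟩
        suc (2 * length M + t)
          ≡⟨ cong (λ k → suc (length M + k + t)) (+-identityʳ (length M)) ⟩
        suc (length M + length M) + t
          ∎
        where open ≡.≡-Reasoning

      maximal-bound : q ≤ length M
      maximal-bound = double≤odd⇒≤ (+-cancelʳ-≤ t (q + q) _
        (subst₂ _≤_ size length-listing (enumeration⇒≤length listed)))

    module _ {m} (m≤q : m ≤ q) (m+m≤t : m + m ≤ t) where

      spokesAndPairs : List (Edge (suc N))
      spokesAndPairs = applyUpTo (clampEdge ∘ spoke) (m + m) ++ applyUpTo (clampEdge ∘ pair ∘ (m +_)) (q ∸ m)

      spokesAndPairs-matching : IsMatching graph spokesAndPairs
      spokesAndPairs-matching = matching-++ graph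
        (matching-applyUpTo spoke (m + m) spoke-edge′ λ i<j j<2m →
          spokes-disjoint (<⇒≢ i<j) (in-A (<-trans i<j j<2m)) (in-A j<2m))
        (matching-applyUpTo (pair ∘ (m +_)) (q ∸ m) (pair-edge ∘ shifted) λ i<j _ →
          pairs-disjoint (<⇒≢ i<j ∘ +-cancelˡ-≡ m _ _))
        (cross-disjoint-applyUpTo spoke (m + m) spoke-edge′
          (pair ∘ (m +_)) (q ∸ m) (proj₁ ∘ pair-edge ∘ shifted)
          λ j<2m i<d → spoke-pair-disjoint j<2m (m≤m+n m _) (shifted i<d))
        where
        in-A : ∀ {j} → j < m + m → InA j
        in-A j<2m = <-≤-trans j<2m (+-mono-≤ m≤q m≤q)
        spoke-edge′ : ∀ {j} → j < m + m → IsEdgePair (spoke j)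
        spoke-edge′ j<2m = spoke-edge (in-A j<2m) (<-≤-trans j<2m m+m≤t)
        shifted : ∀ {i} → i < q ∸ m → m + i < q
        shifted {i} i<d = subst (m + i <_) (m+[n∸m]≡n m≤q) (+-monoʳ-< m i<d)

      length-spokesAndPairs : length spokesAndPairs ≡ q + m
      length-spokesAndPairs = begin
        length spokesAndPairs       ≡⟨ length-++ (applyUpTo (clampEdge ∘ spoke) (m + m)) ⟩
        length (applyUpTo (clampEdge ∘ spoke) (m + m)) + length (applyUpTo (clampEdge ∘ pair ∘ (m +_)) (q ∸ m))
                                    ≡⟨ cong₂ _+_ (length-applyUpTo _ (m + m)) (length-applyUpTo _ (q ∸ m)) ⟩
        m + m + (q ∸ m)             ≡⟨ +-assoc m m (q ∸ m) ⟩
        m + (m + (q ∸ m))           ≡⟨ cong (m +_) (m+[n∸m]≡n m≤q) ⟩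
        m + q                       ≡⟨ +-comm m q ⟩
        q + m                       ∎
        where open ≡.≡-Reasoning

    maximum-bound : ∀ {m M} → t ≤ suc (m + m) → IsMatching graph M → length M ≤ q + m
    maximum-bound {m} {M} t≤ matching = double≤odd⇒≤ (begin
      length M + length M      ≡⟨ cong (length M +_) (+-identityʳ (length M)) ⟨
      2 * length M             ≤⟨ matching-order-bound graph matching [] [] ⟩
      suc N                    ≡⟨ size ⟩
      q + q + t                ≤⟨ +-monoʳ-≤ (q + q) t≤ ⟩
      q + q + suc (m + m)      ≡⟨ regroup q m ⟩
      suc (q + m + (q + m))    ∎)
      where
      open ≤-Reasoning
      regroup : ∀ a b → a + a + suc (b + b) ≡ suc (a + b + (a + b))
      regroup = solve-∀

    0∈A : InA 0
    0∈A = <-≤-trans (s≤s z≤n) (+-mono-≤ (≤-trans 1≤p p≤q) (z≤n {q}))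

    connected-via-B : 1 ≤ t → Connected graph
    connected-via-B 1≤t = hub⇒connected graph b₀ reach
      where
      b₀ : Fin (suc N)
      b₀ = clamp (q + q)
      b₀∉A : ¬ InA (toℕ b₀)
      b₀∉A b₀∈A = n≮n (q + q) (subst (_< q + q) (toℕ-clamp (bounded (m<m+n (q + q) 1≤t))) b₀∈A)
      to-b₀ : ∀ {v} → InA (toℕ v) → adj graph v b₀ ≡ true
      to-b₀ v∈A = R⇒edge (across-adjacent v∈A b₀∉A)
      reach : ∀ v → Reachable graph v b₀
      reach v with toℕ v <? q + q
      ... | yes v∈A = step (to-b₀ v∈A) here
      ... | no v∉A =
        step (R⇒edge (Adjacent-sym (across-adjacent 0∈A v∉A))) (step (to-b₀ {Fin.zero} 0∈A) here)

    connected-single-class : p ≡ 1 → Connected graph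
    connected-single-class p≡1 = hub⇒connected graph Fin.zero reach
      where
      class≡0 : ∀ {x} → InA x → class x ≡ 0
      class≡0 x∈A = n<1⇒n≡0 (subst (class _ <_) p≡1 (class-< x∈A))
      reach : ∀ v → Reachable graph v Fin.zero
      reach v with toℕ v <? q + q
      ... | no v∉A = step (R⇒edge (Adjacent-sym (across-adjacent 0∈A v∉A))) here
      ... | yes v∈A with toℕ v ≟ 0
      ...   | yes v≡0 = subst (λ u → Reachable graph u Fin.zero) (≡.sym (Fin.toℕ-injective v≡0)) here
      ...   | no v≢0 =
        step (R⇒edge (inner-adjacent v≢0 v∈A 0∈A (trans (class≡0 v∈A) (≡.sym (class≡0 0∈A))))) here

    realizes : ∀ {m} → m ≤ q → m + m ≤ t → t ≤ suc (m + m) → p ≡ 1 ⊎ 1 ≤ t →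
               Realizes graph p q (q + m)
    realizes m≤q m+m≤t t≤ connectivity =
      Sum.[ connected-single-class , connected-via-B ] connectivity ,
      ((inducedPairs , inducedPairs-induced , length-applyUpTo _ p) , λ _ → induced-bound) ,
      ((allPairs , allPairs-maximal , length-applyUpTo _ q) , λ _ → MaximalMatching.maximal-bound) ,
      ((spokesAndPairs m≤q m+m≤t ,
        spokesAndPairs-matching m≤q m+m≤t , length-spokesAndPairs m≤q m+m≤t) ,
       λ _ → maximum-bound t≤)

realization : ∀ {p q r} → 1 ≤ p → p ≤ q → q ≤ r → r ≤ 2 * q → p ≡ 1 ⊎ q < r →
              Σ (Graph (2 * r)) λ G → Realizes G p q r
realization {r = zero} 1≤p p≤q q≤r _ _ = ⊥-elim (<⇒≱ (≤-trans 1≤p (≤-trans p≤q q≤r)) z≤n)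
realization {p} {q} {r@(suc r′)} 1≤p p≤q q≤r r≤2q p≡1⊎q<r =
  Witness.graph , subst (Realizes Witness.graph p q) (≡.sym r≡q+m)
    (Witness.realizes m≤q ≤-refl (n≤1+n _)
      (Sum.map₂ (λ q<r → ≤-trans (m<n⇒0<n∸m q<r) (m≤m+n m m)) p≡1⊎q<r))
  where
  m : ℕ
  m = r ∸ q
  r≡q+m : r ≡ q + m
  r≡q+m = ≡.sym (m+[n∸m]≡n q≤r)
  m≤q : m ≤ q
  m≤q = +-cancelˡ-≤ q m q (subst₂ _≤_ r≡q+m (cong (q +_) (+-identityʳ q)) r≤2q)
  double : ∀ a b → 2 * (a + b) ≡ a + a + (b + b)
  double = solve-∀
  module Witness = Construction.Realization q p 1≤p p≤q (m + m) (r′ + suc (r′ + 0))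
                         (trans (cong (2 *_) r≡q+m) (double q m))

realization-odd : ∀ {p r} → 1 ≤ p → p ≤ r → Σ (Graph (suc (2 * r))) λ G → Realizes G p r r
realization-odd {p} {r} 1≤p p≤r =
  Witness.graph , subst (Realizes Witness.graph p r) (+-identityʳ r)
    (Witness.realizes z≤n z≤n ≤-refl (inj₂ ≤-refl))
  where
  size : ∀ a → suc (2 * a) ≡ a + a + 1
  size = solve-∀
  module Witness = Construction.Realization r p 1≤p p≤r 1 (2 * r) (size r)

theorem2p1 : ∀ (p q r : ℕ) → 1 ≤ p → p ≤ q → q ≤ r → r ≤ 2 * q →
      MinOrder 1 q r (2 * r)
    × (2 ≤ p → q < r → MinOrder p q r (2 * r))
    × (2 ≤ p → q ≡ r → MinOrder p r r (suc (2 * r)))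
theorem2p1 p q r 1≤p p≤q q≤r r≤2q =
  (realization ≤-refl (≤-trans 1≤p p≤q) q≤r r≤2q (inj₁ refl) , λ _ G → matching-number⇒order≥ G) ,
  (λ _ q<r → realization 1≤p p≤q q≤r r≤2q (inj₂ q<r) , λ _ G → matching-number⇒order≥ G) ,
  (λ 2≤p q≡r → realization-odd 1≤p (subst (p ≤_) q≡r p≤q) , λ _ G → induced-pair⇒order> G 2≤p)
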